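{- The Petersen graph $H$ satisfies $i_{1,1}(H)=3$.
   Context: Discrete-time immunization model with $r=s=1$. For a finite graph $H$, a protocol is a finite sequence $(A_1,\dots,A_N)$ of subsets of $V(H)$ (vertices immunized at time-step $t$); its width is $\max_i|A_i|$. At time $0$ all vertices are red. For $t\ge1$ each vertex is green, yellow or red at time $t$: if $v\in A_t$ then $v$ is green; otherwise, a vertex red or yellow at time $t-1$ is red at time $t$, and a vertex green at time $t-1$ becomes yellow at time $t$ if it has a neighbor that is red at time $t$, and stays green otherwise. The protocol clears $H$ if all vertices are green at time $N$. $i_{1,1}(H)$ is the minimum width of a protocol that clears $H$. -}

module Defs where

open import Data.Nat using (ℕ; _⊔_; _≥_)
open import Data.Bool using (Bool; true; false; _∧_; _∨_; not; if_then_else_)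
open import Data.Fin using (Fin; _≟_; #_)
open import Data.Fin.Subset using (Subset; ∣_∣)
open import Data.Vec using (lookup)
open import Data.List using (List; []; _∷_; foldl; foldr; map)
open import Data.Bool.ListAction using (any)
open import Data.List using () renaming (allFin to allFinL)
open import Data.Product using (Σ; _×_; _,_)
open import Relation.Nullary.Decidable using (⌊_⌋; toWitness)
open import Data.Fin.Properties using (all?)
import Data.Bool.Properties as Bool
open import Data.Unit using (tt)
open import Relation.Binary.PropositionalEquality using (_≡_)

record Graph (n : ℕ) : Set where
  field
    adj : Fin n → Fin n → Bool
    sym : ∀ u v → adj u v ≡ adj v u
    irrefl : ∀ v → adj v v ≡ false
open Graph public

data Colour : Set where
  green yellow red : Colour

isGreen : Colour → Bool
isGreen green = true
isGreen yellow = false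
isGreen red = false

State : ℕ → Set
State n = Fin n → Colour

initial : ∀ {n} → State n
initial _ = red

-- A protocol: the list (A_1, ..., A_N) of immunized sets.
Protocol : ℕ → Set
Protocol n = List (Subset n)

redNext : ∀ {n} → State n → Subset n → Fin n → Bool
redNext s A u = not (lookup A u) ∧ not (isGreen (s u))

step : ∀ {n} → Graph n → State n → Subset n → State n
step {n} G s A v with lookup A v | isGreen (s v)
... | true  | _     = green
... | false | false = red
... | false | true  =
  if any (λ u → adj G v u ∧ redNext s A u) (allFinL n) then yellow else green

run : ∀ {n} → Graph n → Protocol n → State n
run G P = foldl (step G) initial P

width : ∀ {n} → Protocol n → ℕ
width P = foldr _⊔_ 0 (map ∣_∣ P)

Clears : ∀ {n} → Graph n → Protocol n → Set
Clears G P = ∀ v → run G P v ≡ green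

i₁₁≡ : ∀ {n} → Graph n → ℕ → Set
i₁₁≡ {n} G k =
  (Σ (Protocol n) λ P → Clears G P × width P ≡ k)
  × (∀ (P : Protocol n) → Clears G P → width P ≥ k)

-- The Petersen graph: outer 5-cycle 0..4, spokes i—i+5, inner pentagram i+5 — (i+2 mod 5)+5.
petersenEdges : List (Fin 10 × Fin 10)
petersenEdges =
  (# 0 , # 1) ∷ (# 1 , # 2) ∷ (# 2 , # 3) ∷ (# 3 , # 4) ∷ (# 4 , # 0) ∷
  (# 0 , # 5) ∷ (# 1 , # 6) ∷ (# 2 , # 7) ∷ (# 3 , # 8) ∷ (# 4 , # 9) ∷
  (# 5 , # 7) ∷ (# 7 , # 9) ∷ (# 9 , # 6) ∷ (# 6 , # 8) ∷ (# 8 , # 5) ∷ []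

petersenAdj : Fin 10 → Fin 10 → Bool
petersenAdj u v = any (λ { (a , b) → (⌊ u ≟ a ⌋ ∧ ⌊ v ≟ b ⌋) ∨ (⌊ u ≟ b ⌋ ∧ ⌊ v ≟ a ⌋) }) petersenEdges

symP : ∀ u v → petersenAdj u v ≡ petersenAdj v u
symP = toWitness {a? = all? λ u → all? λ v → petersenAdj u v Bool.≟ petersenAdj v u} tt

irrP : ∀ v → petersenAdj v v ≡ false
irrP = toWitness {a? = all? λ v → petersenAdj v v Bool.≟ false} tt

petersen : Graph 10
petersen = record { adj = petersenAdj ; sym = symP ; irrefl = irrP }

-- Under width 2 the Petersen graph never has more than three green vertices. One step of the
-- process sees the previous state only through its green set, so this invariant is a finite check
-- over green sets of size at most 3 and immunized sets of size at most 2; hence width 2 can never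
-- make all ten vertices green, while an explicit protocol of width 3 does.
module Submission where

open import Defs hiding (sym)
open import Data.Nat using (ℕ; zero; suc; _≤_; _<_; z≤n; s≤s; _≤ᵇ_)
open import Data.Nat.Properties using (m⊔n≤o⇒m≤o; m⊔n≤o⇒n≤o; ≰⇒>; <⇒≱; ≤ᵇ⇒≤; module ≤-Reasoning)
open import Data.Bool using (Bool; true; false; _∧_; _∨_; not; if_then_else_; T)
import Data.Bool.Properties as Bool
open import Data.Fin using (Fin)
open import Data.Fin.Subset using (Subset; ∣_∣; ⊤; ⊥; inside; outside)
open import Data.Fin.Subset.Properties using (∣⊤∣≡n; ∣⊥∣≡0)
open import Data.Fin.Properties using (all?)
open import Data.Vec using ([]; _∷_; lookup; tabulate; replicate)
open import Data.Vec.Properties using (lookup∘tabulate; tabulate-cong)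
open import Data.List using (List; []; _∷_; foldl; map; _++_)
open import Data.List using () renaming (allFin to allFinL)
open import Data.List.Properties using (map-cong)
open import Data.List.Relation.Unary.All as All using (All)
open import Data.List.Relation.Unary.Any using (here)
open import Data.List.Membership.Propositional using (_∈_)
open import Data.List.Membership.Propositional.Properties using (∈-map⁺; ∈-++⁺ˡ; ∈-++⁺ʳ)
open import Data.Bool.ListAction using (any; or; all)
open import Data.List.Relation.Unary.All.Properties using (all⁺)
open import Data.Product using (_,_)
open import Data.Unit using (tt)
open import Function using (_∘_; Equivalence)
open import Relation.Nullary.Decidable using (toWitness)
open import Relation.Binary.PropositionalEquality using (_≡_; refl; cong; trans; sym; subst)

greenSet : ∀ {n} → State n → Subset n
greenSet s = tabulate (isGreen ∘ s)

tabulate-const : ∀ {A : Set} n (x : A) → tabulate {n = n} (λ _ → x) ≡ replicate n x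
tabulate-const zero    x = refl
tabulate-const (suc n) x = cong (x ∷_) (tabulate-const n x)

greenSet-initial : ∀ {n} → greenSet (initial {n}) ≡ ⊥
greenSet-initial {n} = tabulate-const n outside

greenSet-onlyGreen : ∀ {n} (s : State n) → (∀ v → s v ≡ green) → greenSet s ≡ ⊤
greenSet-onlyGreen {n} s allGreen =
  trans (tabulate-cong (λ v → cong isGreen (allGreen v))) (tabulate-const n inside)

-- step sees the previous state only through which vertices are green, so it induces this map on
-- green sets (see greenSet-step).
nextGreenAt : ∀ {n} → Graph n → (Fin n → Bool) → Subset n → Fin n → Bool
nextGreenAt {n} H g A v =
  lookup A v ∨ (g v ∧ not (any (λ u → adj H v u ∧ (not (lookup A u) ∧ not (g u))) (allFinL n)))

nextGreen : ∀ {n} → Graph n → Subset n → Subset n → Subset n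
nextGreen H g A = tabulate (nextGreenAt H (lookup g) A)

nextGreenAt-cong : ∀ {n} (H : Graph n) {g h : Fin n → Bool} → (∀ u → g u ≡ h u) →
                   ∀ A v → nextGreenAt H g A v ≡ nextGreenAt H h A v
nextGreenAt-cong {n} H {g} {h} g≗h A v with g v | h v | g≗h v
... | false | .false | refl = refl
... | true  | .true  | refl =
  cong (λ b → lookup A v ∨ not b)
       (cong or (map-cong (λ u → cong (λ b → adj H v u ∧ (not (lookup A u) ∧ not b)) (g≗h u))
                          (allFinL n)))

isGreen-step : ∀ {n} (H : Graph n) s A v → isGreen (step H s A v) ≡ nextGreenAt H (isGreen ∘ s) A v
isGreen-step H s A v with lookup A v | isGreen (s v)
... | true  | _     = refl
... | false | false = refl
... | false | true  = isGreen-ifYellow _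
  where
  isGreen-ifYellow : ∀ b → isGreen (if b then yellow else green) ≡ not b
  isGreen-ifYellow true  = refl
  isGreen-ifYellow false = refl

greenSet-step : ∀ {n} (H : Graph n) s A → greenSet (step H s A) ≡ nextGreen H (greenSet s) A
greenSet-step H s A = tabulate-cong λ v →
  trans (isGreen-step H s A v)
        (nextGreenAt-cong H (λ u → sym (lookup∘tabulate (isGreen ∘ s) u)) A v)

GreenBounded : ∀ {n} → Graph n → ℕ → ℕ → Set
GreenBounded {n} H k m = ∀ (g A : Subset n) → ∣ g ∣ ≤ m → ∣ A ∣ ≤ k → ∣ nextGreen H g A ∣ ≤ m

greenSet-foldl-bounded : ∀ {n} {H : Graph n} {k m} → GreenBounded H k m →
  ∀ s (P : Protocol n) → ∣ greenSet s ∣ ≤ m → width P ≤ k → ∣ greenSet (foldl (step H) s P) ∣ ≤ m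
greenSet-foldl-bounded bounded s [] s≤m P≤k = s≤m
greenSet-foldl-bounded {H = H} {m = m} bounded s (A ∷ P) s≤m AP≤k =
  greenSet-foldl-bounded bounded (step H s A) P
    (subst (λ g → ∣ g ∣ ≤ m) (sym (greenSet-step H s A))
           (bounded (greenSet s) A s≤m (m⊔n≤o⇒m≤o ∣ A ∣ (width P) AP≤k)))
    (m⊔n≤o⇒n≤o ∣ A ∣ (width P) AP≤k)

clears⇒width> : ∀ {n} {H : Graph n} {k m} → GreenBounded H k m → m < n →
                ∀ P → Clears H P → k < width P
clears⇒width> {n} {H} {k} {m} bounded m<n P clears = ≰⇒> λ P≤k → <⇒≱ m<n (n≤m P≤k)
  where
  n≤m : width P ≤ k → n ≤ m
  n≤m P≤k = begin
    n                        ≡⟨ sym (∣⊤∣≡n n) ⟩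
    ∣ ⊤ {n} ∣                ≡⟨ cong ∣_∣ (sym (greenSet-onlyGreen (run H P) clears)) ⟩
    ∣ greenSet (run H P) ∣   ≤⟨ greenSet-foldl-bounded bounded initial P ∣greenSet-initial∣≤m P≤k ⟩
    m                        ∎
    where
    open ≤-Reasoning
    ∣greenSet-initial∣≤m : ∣ greenSet (initial {n}) ∣ ≤ m
    ∣greenSet-initial∣≤m = subst (_≤ m) (sym (trans (cong ∣_∣ (greenSet-initial {n})) (∣⊥∣≡0 n))) z≤n

subsetsOfSize≤ : ∀ n → ℕ → List (Subset n)
subsetsOfSize≤ zero    k       = [] ∷ []
subsetsOfSize≤ (suc n) zero    = map (outside ∷_) (subsetsOfSize≤ n zero)
subsetsOfSize≤ (suc n) (suc k) = map (outside ∷_) (subsetsOfSize≤ n (suc k))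
                              ++ map (inside ∷_) (subsetsOfSize≤ n k)

∈-subsetsOfSize≤ : ∀ {n k} (p : Subset n) → ∣ p ∣ ≤ k → p ∈ subsetsOfSize≤ n k
∈-subsetsOfSize≤ []                      _   = here refl
∈-subsetsOfSize≤ {k = zero}  (outside ∷ p) p≤k = ∈-map⁺ (outside ∷_) (∈-subsetsOfSize≤ p p≤k)
∈-subsetsOfSize≤ {k = suc k} (outside ∷ p) p≤k =
  ∈-++⁺ˡ (∈-map⁺ (outside ∷_) (∈-subsetsOfSize≤ p p≤k))
∈-subsetsOfSize≤ {k = suc k} (inside ∷ p) (s≤s p≤k) =
  ∈-++⁺ʳ (map (outside ∷_) (subsetsOfSize≤ _ (suc k))) (∈-map⁺ (inside ∷_) (∈-subsetsOfSize≤ p p≤k))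

all≡true⇒All : ∀ {A : Set} (p : A → Bool) xs → all p xs ≡ true → All (T ∘ p) xs
all≡true⇒All p xs all≡true = all⁺ p xs (Equivalence.from Bool.T-≡ all≡true)

nextGreen≤ᵇ3 : Subset 10 → Subset 10 → Bool
nextGreen≤ᵇ3 g A = ∣ nextGreen petersen g A ∣ ≤ᵇ 3

allNextGreen≤ᵇ3 : Subset 10 → Bool
allNextGreen≤ᵇ3 g = all (nextGreen≤ᵇ3 g) (subsetsOfSize≤ 10 2)

-- The check is kept as an equation with true and only ever used through all≡true⇒All: wherever
-- the checker has to compare T (all …) it evaluates the whole search with its slow reduction.
petersen-exhaustiveCheck : all allNextGreen≤ᵇ3 (subsetsOfSize≤ 10 3) ≡ true
petersen-exhaustiveCheck = refl

petersen-greenBounded : GreenBounded petersen 2 3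
petersen-greenBounded g A g≤3 A≤2 =
  ≤ᵇ⇒≤ _ 3 (All.lookup (all⁺ (nextGreen≤ᵇ3 g) (subsetsOfSize≤ 10 2) checkedAtG) (∈-subsetsOfSize≤ A A≤2))
  where
  checkedAtG : T (allNextGreen≤ᵇ3 g)
  checkedAtG = All.lookup (all≡true⇒All allNextGreen≤ᵇ3 (subsetsOfSize≤ 10 3) petersen-exhaustiveCheck)
                          (∈-subsetsOfSize≤ g g≤3)

-- Immunize {0,1}, {2,3,6}, {0,4,7}, {3,5,9}, {1,6,8}.
petersenProtocol : Protocol 10
petersenProtocol =
  (inside  ∷ inside  ∷ outside ∷ outside ∷ outside ∷ outside ∷ outside ∷ outside ∷ outside ∷ outside ∷ []) ∷
  (outside ∷ outside ∷ inside  ∷ inside  ∷ outside ∷ outside ∷ inside  ∷ outside ∷ outside ∷ outside ∷ []) ∷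
  (inside  ∷ outside ∷ outside ∷ outside ∷ inside  ∷ outside ∷ outside ∷ inside  ∷ outside ∷ outside ∷ []) ∷
  (outside ∷ outside ∷ outside ∷ inside  ∷ outside ∷ inside  ∷ outside ∷ outside ∷ outside ∷ inside  ∷ []) ∷
  (outside ∷ inside  ∷ outside ∷ outside ∷ outside ∷ outside ∷ inside  ∷ outside ∷ inside  ∷ outside ∷ []) ∷
  []

petersenProtocol-clears : Clears petersen petersenProtocol
petersenProtocol-clears v = isGreen⇒≡green (toWitness
  {a? = all? λ v → isGreen (run petersen petersenProtocol v) Bool.≟ true} tt v)
  where
  isGreen⇒≡green : ∀ {c} → isGreen c ≡ true → c ≡ green
  isGreen⇒≡green {green} _ = refl

proposition4p5 : i₁₁≡ petersen 3
proposition4p5 =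
    (petersenProtocol , petersenProtocol-clears , refl)
  , clears⇒width> petersen-greenBounded (s≤s (s≤s (s≤s (s≤s z≤n))))
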